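{- Let $\Phi=Q_1x_1\ldots Q_nx_n.\,C_1\land\dots\land C_m$ be a PCNF formula and let $L_1,\dots,L_k$ be an OBDD derivation from $\Phi$. If $\Phi$ is true, then the QBF $Q_1x_1\ldots Q_nx_n.\,L_1\land\dots\land L_k$ is true.
   Context: $Q_i\in\{\exists,\forall\}$, $x_i$ distinct variables, $C_j$ clauses; truth of a QBF is the usual semantics. An OBDD derivation from $\Phi$ is a sequence $L_1,\dots,L_k$ of ordered binary decision diagrams, all with the same variable order, such that for $1\le i\le m$ the OBDD $L_i$ represents $C_i$, and every other $L_i$ is derived by one of: (conjunction) $L_i$ represents $L_j\land L_{j'}$, $j,j'<i$; (projection) $L_i$ represents $\exists x.L_j$ for some variable $x$ of $L_j$, $j<i$; (entailment) $L_i$ is logically entailed by $L_{i_1},\dots,L_{i_r}$, all $i_t<i$; (universal reduction) $L_i$ represents $L_j[u/c]$, where $j<i$, $u$ is a universally quantified variable rightmost in the quantifier prefix among the variables of $L_j$, $c\in\{0,1\}$, and $L_j[u/c]$ is obtained by substituting $c$ for $u$. -}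

module Defs where

open import Data.Nat using (ℕ; zero; suc; _≤_; _<_)
open import Data.Fin using (Fin; toℕ)
open import Data.Bool using (Bool; true; false; _∧_; _∨_; if_then_else_)
open import Data.Vec using (Vec; []; _∷_; lookup; _[_]≔_)
open import Data.List using (List; tabulate)
open import Data.Bool.ListAction using (all; any)
open import Data.List.Relation.Unary.All using (All)
open import Data.List.Membership.Propositional using (_∈_)
open import Data.Product using (_×_; Σ; ∃; ∃-syntax; _,_)
open import Data.Sum using (_⊎_)
open import Relation.Binary.PropositionalEquality using (_≡_)
open import Function.Definitions using (Injective)

-- Quantified Boolean formulas in prenex CNF.
-- Variables x_1,…,x_n are represented by Fin n (x_{i+1} ↔ i); the
-- quantifier prefix is Q_1 x_1 … Q_n x_n, in the order of Fin n.

data Quant : Set where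
  ∃q ∀q : Quant

Assignment : ℕ → Set
Assignment n = Vec Bool n

Literal : ℕ → Set
Literal n = Fin n × Bool

Clause : ℕ → Set
Clause n = List (Literal n)

evalLit : ∀ {n} → Assignment n → Literal n → Bool
evalLit a (x , true)  = lookup a x
evalLit a (x , false) = if lookup a x then false else true

evalClause : ∀ {n} → Assignment n → Clause n → Bool
evalClause a c = any (evalLit a) c

qbfTrue : ∀ {k} → Vec Quant k → (Assignment k → Bool) → Bool
qbfTrue []         f = f []
qbfTrue (∃q ∷ qs) f = qbfTrue qs (λ v → f (true ∷ v)) ∨ qbfTrue qs (λ v → f (false ∷ v))
qbfTrue (∀q ∷ qs) f = qbfTrue qs (λ v → f (true ∷ v)) ∧ qbfTrue qs (λ v → f (false ∷ v))

cnfEval : ∀ {n m} → (Fin m → Clause n) → Assignment n → Bool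
cnfEval {m = m} C a = all (λ j → evalClause a (C j)) (tabulate {n = m} (λ j → j))

-- A variable order is an injective ranking π : Fin n → ℕ.
-- Diagrams are given as decision graphs unfolded into trees (sharing
-- of nodes does not affect semantics or the set of variables).

data BDD (n : ℕ) : Set where
  leaf : Bool → BDD n
  node : Fin n → (lo hi : BDD n) → BDD n

evalBDD : ∀ {n} → Assignment n → BDD n → Bool
evalBDD a (leaf b)       = b
evalBDD a (node x lo hi) = if lookup a x then evalBDD a hi else evalBDD a lo

data OrderedFrom {n} (π : Fin n → ℕ) : ℕ → BDD n → Set where
  leaf : ∀ {r b} → OrderedFrom π r (leaf b)
  node : ∀ {r x lo hi} → r ≤ π x →
         OrderedFrom π (suc (π x)) lo → OrderedFrom π (suc (π x)) hi →
         OrderedFrom π r (node x lo hi)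

IsOBDD : ∀ {n} → (Fin n → ℕ) → BDD n → Set
IsOBDD π L = OrderedFrom π 0 L

data _∈vars_ {n} (x : Fin n) : BDD n → Set where
  here : ∀ {lo hi} → x ∈vars node x lo hi
  inLo : ∀ {y lo hi} → x ∈vars lo → x ∈vars node y lo hi
  inHi : ∀ {y lo hi} → x ∈vars hi → x ∈vars node y lo hi

Represents : ∀ {n} → BDD n → (Assignment n → Bool) → Set
Represents {n} L f = (a : Assignment n) → evalBDD a L ≡ f a

-- OBDD derivations.  L : Fin k → BDD n is the sequence L_1,…,L_k
-- (index i ↔ L_{i+1}); clauses C : Fin m → Clause n.

module _ {n m k : ℕ} (Q : Vec Quant n) (C : Fin m → Clause n) (L : Fin k → BDD n) where

  Conjunction : Fin k → Set
  Conjunction i = ∃[ j ] ∃[ j' ] (toℕ j < toℕ i × toℕ j' < toℕ i ×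
    Represents (L i) (λ a → evalBDD a (L j) ∧ evalBDD a (L j')))

  Projection : Fin k → Set
  Projection i = ∃[ j ] ∃[ x ] (toℕ j < toℕ i × x ∈vars L j ×
    Represents (L i) (λ a → evalBDD (a [ x ]≔ false) (L j) ∨ evalBDD (a [ x ]≔ true) (L j)))

  Entailment : Fin k → Set
  Entailment i = Σ (List (Fin k)) λ is → All (λ j → toℕ j < toℕ i) is ×
    ((a : Assignment n) → All (λ j → evalBDD a (L j) ≡ true) is → evalBDD a (L i) ≡ true)

  UniversalReduction : Fin k → Set
  UniversalReduction i = ∃[ j ] ∃[ u ] ∃[ c ] (toℕ j < toℕ i × u ∈vars L j ×
    lookup Q u ≡ ∀q × ((y : Fin n) → y ∈vars L j → toℕ y ≤ toℕ u) ×
    Represents (L i) (λ a → evalBDD (a [ u ]≔ c) (L j)))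

  record OBDDDerivation (π : Fin n → ℕ) : Set where
    field
      order-injective : Injective _≡_ _≡_ π
      allOrdered      : (i : Fin k) → IsOBDD π (L i)
      m≤k             : m ≤ k
      axioms          : (i : Fin k) → (p : toℕ i < m) →
                        Represents (L i) (λ a → evalClause a (C (Data.Fin.fromℕ< p)))
      derived         : (i : Fin k) → m ≤ toℕ i →
                        Conjunction i ⊎ Projection i ⊎ Entailment i ⊎ UniversalReduction i

bddConj : ∀ {n k} → (Fin k → BDD n) → Assignment n → Bool
bddConj {k = k} L a = all (λ i → evalBDD a (L i)) (tabulate {n = k} (λ i → i))

{-# OPTIONS --safe #-}
-- A true QBF has a winning strategy for the existential player: a tree of
-- Boolean choices, each depending on the universal values played so far.
-- Every line of an OBDD derivation holds on every play consistent with such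
-- a strategy, by induction along the derivation.  The only delicate rule is
-- universal reduction: L[u/c] is evaluated at a play a, but since every
-- variable of L is at most u and the strategy may be replayed with u set to c
-- after the same prefix, there is a consistent play agreeing with a[u:=c] on
-- all variables of L.  Hence the strategy also wins L_1 ∧ … ∧ L_k.
module Submission where

open import Defs
open import Data.Nat using (ℕ; z≤n; s≤s; _<?_)
open import Data.Nat.Properties using (≮⇒≥)
open import Data.Fin using (Fin; toℕ; zero; suc; _<_; _≤_)
open import Data.Fin.Induction using (<-wellFounded)
open import Data.Vec using (Vec; []; _∷_; lookup; _[_]≔_)
open import Data.Vec.Properties using ([]≔-lookup)
open import Data.Bool using (Bool; true; false; _∧_; _∨_)
open import Data.Bool.Properties using (∧-conicalˡ; ∧-conicalʳ; ∨-zeroʳ)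
open import Data.Bool.ListAction using (all)
open import Data.List using (List; []; _∷_)
open import Data.List.Relation.Unary.All as All using (All; []; _∷_)
open import Data.List.Relation.Unary.All.Properties using (tabulate⁺; tabulate⁻)
open import Data.Product using (Σ; ∃-syntax; _×_; _,_)
open import Data.Sum using (_⊎_; inj₁; inj₂)
open import Data.Unit using (⊤; tt)
open import Induction.WellFounded as WF using ()
open import Relation.Nullary using (yes; no)
open import Relation.Binary.PropositionalEquality using (_≡_; refl; sym; trans; cong₂; subst)

all≡true⇒All : {A : Set} (p : A → Bool) (xs : List A) →
  all p xs ≡ true → All (λ x → p x ≡ true) xs
all≡true⇒All p []       _ = []
all≡true⇒All p (x ∷ xs) h = ∧-conicalˡ _ _ h ∷ all≡true⇒All p xs (∧-conicalʳ _ _ h)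

All⇒all≡true : {A : Set} (p : A → Bool) {xs : List A} →
  All (λ x → p x ≡ true) xs → all p xs ≡ true
All⇒all≡true p []           = refl
All⇒all≡true p (px ∷ pxs) rewrite px = All⇒all≡true p pxs

∨≡true⇒⊎ : (x : Bool) {y : Bool} → x ∨ y ≡ true → x ≡ true ⊎ y ≡ true
∨≡true⇒⊎ true  _ = inj₁ refl
∨≡true⇒⊎ false h = inj₂ h

∨-witness : (g : Bool → Bool) (b : Bool) → g b ≡ true → g false ∨ g true ≡ true
∨-witness g false h rewrite h = refl
∨-witness g true  h rewrite h = ∨-zeroʳ (g false)

cnfEval≡true⇒clause : {n m : ℕ} (C : Fin m → Clause n) (a : Assignment n) →
  cnfEval C a ≡ true → (j : Fin m) → evalClause a (C j) ≡ true
cnfEval≡true⇒clause C a h = tabulate⁻ (all≡true⇒All _ _ h)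

bddConj≡true : {n k : ℕ} (L : Fin k → BDD n) (a : Assignment n) →
  ((i : Fin k) → evalBDD a (L i) ≡ true) → bddConj L a ≡ true
bddConj≡true L a h = All⇒all≡true _ (tabulate⁺ h)

evalBDD-cong : {n : ℕ} (B : BDD n) {a b : Assignment n} →
  ((y : Fin n) → y ∈vars B → lookup a y ≡ lookup b y) → evalBDD a B ≡ evalBDD b B
evalBDD-cong (leaf _) agree = refl
evalBDD-cong (node x lo hi) {a} {b} agree
  rewrite agree x here
        | evalBDD-cong lo {a} {b} (λ y y∈lo → agree y (inLo y∈lo))
        | evalBDD-cong hi {a} {b} (λ y y∈hi → agree y (inHi y∈hi)) = refl

projection-sound : {n : ℕ} (f : Assignment n → Bool) (a : Assignment n) (x : Fin n) →
  f a ≡ true → f (a [ x ]≔ false) ∨ f (a [ x ]≔ true) ≡ true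
projection-sound f a x h =
  ∨-witness (λ b → f (a [ x ]≔ b)) (lookup a x)
    (subst (λ a′ → f a′ ≡ true) (sym ([]≔-lookup a x)) h)

-- At a universal variable the strategy holds a reply to each value:
-- (reply after true , reply after false).
Strategy : {n : ℕ} → Vec Quant n → Set
Strategy []         = ⊤
Strategy (∃q ∷ qs) = Bool × Strategy qs
Strategy (∀q ∷ qs) = Strategy qs × Strategy qs

Consistent : {n : ℕ} (Q : Vec Quant n) → Strategy Q → Assignment n → Set
Consistent []         _          []           = ⊤
Consistent (∃q ∷ qs) (b , s)    (x ∷ a)      = x ≡ b × Consistent qs s a
Consistent (∀q ∷ qs) (s₁ , s₀) (true ∷ a)   = Consistent qs s₁ a
Consistent (∀q ∷ qs) (s₁ , s₀) (false ∷ a)  = Consistent qs s₀ a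

Winning : {n : ℕ} (Q : Vec Quant n) → Strategy Q → (Assignment n → Bool) → Set
Winning {n} Q s f = (a : Assignment n) → Consistent Q s a → f a ≡ true

qbfTrue⇒winning : {n : ℕ} (Q : Vec Quant n) (f : Assignment n → Bool) →
  qbfTrue Q f ≡ true → ∃[ s ] Winning Q s f
qbfTrue⇒winning []         f h = tt , λ { [] _ → h }
qbfTrue⇒winning (∃q ∷ qs) f h with ∨≡true⇒⊎ (qbfTrue qs (λ v → f (true ∷ v))) h
... | inj₁ h₁ = let s , w = qbfTrue⇒winning qs _ h₁ in
  (true , s) , λ { (x ∷ a) (refl , c) → w a c }
... | inj₂ h₀ = let s , w = qbfTrue⇒winning qs _ h₀ in
  (false , s) , λ { (x ∷ a) (refl , c) → w a c }
qbfTrue⇒winning (∀q ∷ qs) f h =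
  let s₁ , w₁ = qbfTrue⇒winning qs _ (∧-conicalˡ _ _ h)
      s₀ , w₀ = qbfTrue⇒winning qs _ (∧-conicalʳ _ _ h)
  in (s₁ , s₀) , λ { (true ∷ a) c → w₁ a c ; (false ∷ a) c → w₀ a c }

winning⇒qbfTrue : {n : ℕ} (Q : Vec Quant n) (f : Assignment n → Bool) (s : Strategy Q) →
  Winning Q s f → qbfTrue Q f ≡ true
winning⇒qbfTrue []         f s w = w [] tt
winning⇒qbfTrue (∃q ∷ qs) f (true , s) w
  rewrite winning⇒qbfTrue qs _ s (λ a c → w (true ∷ a) (refl , c)) = refl
winning⇒qbfTrue (∃q ∷ qs) f (false , s) w
  rewrite winning⇒qbfTrue qs _ s (λ a c → w (false ∷ a) (refl , c)) = ∨-zeroʳ _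
winning⇒qbfTrue (∀q ∷ qs) f (s₁ , s₀) w
  rewrite winning⇒qbfTrue qs _ s₁ (λ a c → w (true ∷ a) c)
        | winning⇒qbfTrue qs _ s₀ (λ a c → w (false ∷ a) c) = refl

consistent-exists : {n : ℕ} (Q : Vec Quant n) (s : Strategy Q) → Σ (Assignment n) (Consistent Q s)
consistent-exists []         _          = [] , tt
consistent-exists (∃q ∷ qs) (b , s)    = let a , c = consistent-exists qs s in b ∷ a , refl , c
consistent-exists (∀q ∷ qs) (s₁ , s₀) = let a , c = consistent-exists qs s₁ in true ∷ a , c

consistent-set-universal : {n : ℕ} (Q : Vec Quant n) (s : Strategy Q)
  (a : Assignment n) → Consistent Q s a →
  (u : Fin n) → lookup Q u ≡ ∀q → (c : Bool) →
  Σ (Assignment n) λ a′ → Consistent Q s a′ ×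
    ((y : Fin n) → y ≤ u → lookup a′ y ≡ lookup (a [ u ]≔ c) y)
consistent-set-universal (∀q ∷ qs) (s₁ , s₀) (x ∷ a) _ zero _ true =
  let a′ , c′ = consistent-exists qs s₁ in true ∷ a′ , c′ , λ { zero z≤n → refl }
consistent-set-universal (∀q ∷ qs) (s₁ , s₀) (x ∷ a) _ zero _ false =
  let a′ , c′ = consistent-exists qs s₀ in false ∷ a′ , c′ , λ { zero z≤n → refl }
consistent-set-universal (∃q ∷ qs) (b , s) (x ∷ a) (x≡b , ca) (suc u) uQ c =
  let a′ , ca′ , agree = consistent-set-universal qs s a ca u uQ c
  in x ∷ a′ , (x≡b , ca′) , λ { zero _ → refl ; (suc y) (s≤s y≤u) → agree y y≤u }
consistent-set-universal (∀q ∷ qs) (s₁ , s₀) (true ∷ a) ca (suc u) uQ c =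
  let a′ , ca′ , agree = consistent-set-universal qs s₁ a ca u uQ c
  in true ∷ a′ , ca′ , λ { zero _ → refl ; (suc y) (s≤s y≤u) → agree y y≤u }
consistent-set-universal (∀q ∷ qs) (s₁ , s₀) (false ∷ a) ca (suc u) uQ c =
  let a′ , ca′ , agree = consistent-set-universal qs s₀ a ca u uQ c
  in false ∷ a′ , ca′ , λ { zero _ → refl ; (suc y) (s≤s y≤u) → agree y y≤u }

winning-universal-reduction : {n : ℕ} (Q : Vec Quant n) (s : Strategy Q) (B : BDD n)
  {u : Fin n} → lookup Q u ≡ ∀q → ((y : Fin n) → y ∈vars B → y ≤ u) → (c : Bool) →
  Winning Q s (λ a → evalBDD a B) → Winning Q s (λ a → evalBDD (a [ u ]≔ c) B)
winning-universal-reduction Q s B {u} uQ below c w a ca =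
  let a′ , ca′ , agree = consistent-set-universal Q s a ca u uQ c
  in trans (evalBDD-cong B (λ y y∈B → sym (agree y (below y y∈B)))) (w a′ ca′)

derivation-winning : {n m k : ℕ} (Q : Vec Quant n) (C : Fin m → Clause n)
  (L : Fin k → BDD n) (π : Fin n → ℕ) → OBDDDerivation Q C L π →
  (s : Strategy Q) → Winning Q s (cnfEval C) →
  (i : Fin k) → Winning Q s (λ a → evalBDD a (L i))
derivation-winning {m = m} Q C L π D s wC = WF.All.wfRec <-wellFounded _ LineWins line
  where
  open OBDDDerivation D

  LineWins : Fin _ → Set
  LineWins i = Winning Q s (λ a → evalBDD a (L i))

  line : ∀ i → (∀ {j} → j < i → LineWins j) → LineWins i
  line i ih with toℕ i <? m
  ... | yes i<m = λ a ca → trans (axioms i i<m a) (cnfEval≡true⇒clause C a (wC a ca) _)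
  ... | no i≮m with derived i (≮⇒≥ i≮m)
  ... | inj₁ (j , j′ , j<i , j′<i , rep) =
    λ a ca → trans (rep a) (cong₂ _∧_ (ih j<i a ca) (ih j′<i a ca))
  ... | inj₂ (inj₁ (j , x , j<i , _ , rep)) =
    λ a ca → trans (rep a) (projection-sound (λ a′ → evalBDD a′ (L j)) a x (ih j<i a ca))
  ... | inj₂ (inj₂ (inj₁ (js , js<i , entails))) =
    λ a ca → entails a (All.map (λ j<i → ih j<i a ca) js<i)
  ... | inj₂ (inj₂ (inj₂ (j , u , c , j<i , _ , uQ , below , rep))) =
    λ a ca → trans (rep a) (winning-universal-reduction Q s (L j) uQ below c (ih j<i) a ca)

proposition1 : {n m k : ℕ} (Q : Vec Quant n) (C : Fin m → Clause n)
    (L : Fin k → BDD n) (π : Fin n → ℕ) →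
    OBDDDerivation Q C L π →
    qbfTrue Q (cnfEval C) ≡ true →
    qbfTrue Q (bddConj L) ≡ true
proposition1 Q C L π D Φ-true =
  let s , wins-Φ = qbfTrue⇒winning Q (cnfEval C) Φ-true
  in winning⇒qbfTrue Q (bddConj L) s λ a ca →
       bddConj≡true L a (λ i → derivation-winning Q C L π D s wins-Φ i a ca)
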